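{- Let $(\alpha,\le)$ be a subchain of a totally ordered set $(\beta,\le)$ and let $\langle \mathbf A_u, f_{u\to v}\rangle$ be a direct system of abelian $o$-groups (with order-preserving group homomorphisms) over $\alpha$. For $s\in\beta$ let $\alpha_s=\{i\in\alpha: i\le s\}$ and let $\mathbf B_s$ be the direct limit of the restriction of the system to $\alpha_s$, with canonical maps $\pi_{i\to s}:\mathbf A_i\to\mathbf B_s$ ($i\in\alpha_s$); for $s\in\alpha$ identify $\mathbf B_s=\mathbf A_s$ and $\pi_{i\to s}=f_{i\to s}$. For $i\in\beta\setminus\alpha$ and $j\in\alpha$ with $i<j$, let $\phi_{i\to j}:\mathbf B_i\to\mathbf A_j$ be the unique homomorphism with $\phi_{i\to j}\circ\pi_{k\to i}=f_{k\to j}$ for all $k\in\alpha_i$. For $i<j$ in $\beta\setminus\alpha$ with no $w\in\alpha$ satisfying $i<w<j$ (so $\alpha_i=\alpha_j$), let $id_{i\to j}:\mathbf B_i\to\mathbf B_j$ be the canonical isomorphism (satisfying $id_{i\to j}\circ\pi_{k\to i}=\pi_{k\to j}$). For $i<j$ in $\beta$ define $g_{i\to j}=\pi_{i\to j}$ if $i\in\alpha$ (which equals $f_{i\to j}$ when also $j\in\alpha$); $g_{i\to j}=\phi_{i\to j}$ if $i\in\beta\setminus\alpha$, $j\in\alpha$; $g_{i\to j}=id_{i\to j}$ if $i,j\in\beta\setminus\alpha$ and no $w\in\alpha$ has $i<w<j$; $g_{i\to j}=\pi_{w\to j}\circ\phi_{i\to w}$ if $i,j\in\beta\setminus\alpha$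 and some $w\in\alpha$ has $i<w<j$; and $g_{i\to i}$ the identity. Then $g_{i\to j}$ is well defined (independent of the choice of $w$), and $\langle\mathbf B_u,g_{u\to v}\rangle$ is a direct system of abelian $o$-groups over $\beta$ extending $\langle\mathbf A_u,f_{u\to v}\rangle$. Moreover, for $s\in\beta\setminus\alpha$, $\mathbf B_s$ is the direct limit of the restriction of $\langle\mathbf B_u,g_{u\to v}\rangle$ to $\{i\in\beta: i<s\}$, and for $s\in\alpha$ it is the direct limit of its restriction to $\{i\in\beta: i\le s\}$.
   Context: A direct system over a directed poset $\gamma$ is a family of algebras $\mathbf A_i$ ($i\in\gamma$) with homomorphisms $f_{i\to j}$ for $i\le j$ such that $f_{i\to i}$ is the identity and $f_{i\to k}=f_{j\to k}\circ f_{i\to j}$ for $i\le j\le k$. Its direct limit in the class of abelian $o$-groups (totally ordered abelian groups with order-preserving homomorphisms) is an abelian $o$-group $\mathbf L$ with homomorphisms $\pi_i:\mathbf A_i\to\mathbf L$, $\pi_j\circ f_{i\to j}=\pi_i$, universal among such cocones. Convention: the direct limit over the empty index set is the trivial group. -}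

module Defs where

open import Level using (Level; _⊔_) renaming (suc to lsuc)
open import Algebra.Bundles using (AbelianGroup)
open import Relation.Binary.Core using (Rel)
open import Relation.Binary.Structures using (IsTotalOrder)
open import Relation.Binary.PropositionalEquality using (_≡_; _≢_)
open import Data.Product using (Σ; _×_; _,_; proj₁; proj₂; ∃-syntax)

record OGroup (c ℓ₁ ℓ₂ : Level) : Set (lsuc (c ⊔ ℓ₁ ⊔ ℓ₂)) where
  field
    abGroup : AbelianGroup c ℓ₁
  open AbelianGroup abGroup public
  field
    _≤_          : Rel Carrier ℓ₂
    isTotalOrder : IsTotalOrder _≈_ _≤_
    ≤-compat     : ∀ {x y} z → x ≤ y → (x ∙ z) ≤ (y ∙ z)

module _ {c ℓ₁ ℓ₂ : Level} where

  record Hom (G H : OGroup c ℓ₁ ℓ₂) : Set (c ⊔ ℓ₁ ⊔ ℓ₂) where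
    private
      module G = OGroup G
      module H = OGroup H
    field
      ⟦_⟧   : G.Carrier → H.Carrier
      cong  : ∀ {x y} → x G.≈ y → ⟦ x ⟧ H.≈ ⟦ y ⟧
      homo  : ∀ x y → ⟦ x G.∙ y ⟧ H.≈ (⟦ x ⟧ H.∙ ⟦ y ⟧)
      mono  : ∀ {x y} → x G.≤ y → ⟦ x ⟧ H.≤ ⟦ y ⟧
  open Hom public

  _≗H_ : {G H : OGroup c ℓ₁ ℓ₂} → Hom G H → Hom G H → Set (c ⊔ ℓ₁)
  _≗H_ {G} {H} h k = ∀ x → OGroup._≈_ H (⟦ h ⟧ x) (⟦ k ⟧ x)

  idH : {G : OGroup c ℓ₁ ℓ₂} → Hom G G
  idH {G} = record
    { ⟦_⟧ = λ x → x
    ; cong = λ p → p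
    ; homo = λ _ _ → OGroup.refl G
    ; mono = λ p → p }

  _∘H_ : {G H K : OGroup c ℓ₁ ℓ₂} → Hom H K → Hom G H → Hom G K
  _∘H_ {G} {H} {K} h k = record
    { ⟦_⟧ = λ x → ⟦ h ⟧ (⟦ k ⟧ x)
    ; cong = λ p → cong h (cong k p)
    ; homo = λ x y → OGroup.trans K (cong h (homo k x y)) (homo h _ _)
    ; mono = λ p → mono h (mono k p) }

  infixr 9 _∘H_

  module _ {ι ι' : Level} (I : Set ι) (_≼_ : I → I → Set ι')
           (A : I → OGroup c ℓ₁ ℓ₂)
           (f : ∀ {i j} → i ≼ j → Hom (A i) (A j)) where

    IsDirectSystem : Set (ι ⊔ ι' ⊔ c ⊔ ℓ₁)
    IsDirectSystem =
      (∀ {i} (p : i ≼ i) → f p ≗H idH)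
      × (∀ {i j k} (p : i ≼ j) (q : j ≼ k) (r : i ≼ k) → f r ≗H (f q ∘H f p))

    IsCocone : (L : OGroup c ℓ₁ ℓ₂) → (∀ i → Hom (A i) L) → Set (ι ⊔ ι' ⊔ c ⊔ ℓ₁)
    IsCocone L π = ∀ {i j} (p : i ≼ j) → (π j ∘H f p) ≗H π i

    IsDirectLimit : (L : OGroup c ℓ₁ ℓ₂) → (∀ i → Hom (A i) L)
                  → Set (lsuc (c ⊔ ℓ₁ ⊔ ℓ₂) ⊔ ι ⊔ ι')
    IsDirectLimit L π =
      IsCocone L π
      × (∀ (M : OGroup c ℓ₁ ℓ₂) (σ : ∀ i → Hom (A i) M) → IsCocone M σ →
           Σ (Hom L M) λ h →
             (∀ i → (h ∘H π i) ≗H σ i)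
             × (∀ (h' : Hom L M) → (∀ i → (h' ∘H π i) ≗H σ i) → h' ≗H h))

Strict : ∀ {ι ι'} {X : Set ι} → (X → X → Set ι') → X → X → Set (ι ⊔ ι')
Strict _≤_ x y = (x ≤ y) × (x ≢ y)

module Submission where

open import Defs
open import Level using (Level; _⊔_)
open import Relation.Binary.Bundles using (Setoid)
open import Relation.Binary.Structures using (IsTotalOrder)
open import Relation.Binary.PropositionalEquality using (_≡_; _≢_; refl)
import Relation.Binary.Reasoning.Setoid as SetoidReasoning
open import Relation.Nullary using (¬_)
open import Data.Product using (Σ; _×_; _,_; proj₁; proj₂)

-- Every g_{i→j} is taken to be the map B_i → B_j induced by the cocone π_{·→j} restricted to α_i,
-- and φ_{i→w} the one induced by f_{·→w}.  Since B_i is a direct limit, maps out of it are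
-- determined by their composites with the π_{k→i}; so each clause of the case definition of g,
-- the direct-system laws and the limit properties all reduce to equalities after precomposition
-- with some π_{k→i}.  For s ∉ α, a cocone over {i < s} restricts to one over α_s via the
-- isomorphisms π_{k→k} : A_k → B_k, and that restriction determines it.

module _ {c ℓ₁ ℓ₂ : Level} where

  module _ {G H : OGroup c ℓ₁ ℓ₂} where
    private module H = OGroup H

    ≗H-setoid : Setoid (c ⊔ ℓ₁ ⊔ ℓ₂) (c ⊔ ℓ₁)
    ≗H-setoid = record
      { Carrier = Hom G H
      ; _≈_ = _≗H_
      ; isEquivalence = record
        { refl = λ _ → H.refl
        ; sym = λ eq x → H.sym (eq x)
        ; trans = λ eq eq' x → H.trans (eq x) (eq' x) } }

    ∘H-identityʳ : (h : Hom G H) → (h ∘H idH) ≗H h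
    ∘H-identityʳ _ _ = H.refl

  module ≗H-Reasoning {G H : OGroup c ℓ₁ ℓ₂} = SetoidReasoning (≗H-setoid {G} {H})

  module DirectSystem {ι ι' : Level} (I : Set ι) (_≼_ : I → I → Set ι')
         (A : I → OGroup c ℓ₁ ℓ₂) (f : ∀ {i j} → i ≼ j → Hom (A i) (A j))
         (system : IsDirectSystem I _≼_ A f) where

    module _ {κ : Level} {J : Set κ} (ρ : J → I) where

      below-isCocone : {t : I} (below : ∀ x → ρ x ≼ t) →
        IsCocone J (λ x y → ρ x ≼ ρ y) (λ x → A (ρ x)) f (A t) (λ x → f (below x))
      below-isCocone below {x} {y} p z = OGroup.sym (A _) (proj₂ system p (below y) (below x) z)

      greatest-isDirectLimit : (t : J) (below : ∀ x → ρ x ≼ ρ t) →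
        IsDirectLimit J (λ x y → ρ x ≼ ρ y) (λ x → A (ρ x)) f (A (ρ t)) (λ x → f (below x))
      greatest-isDirectLimit t below =
        below-isCocone below ,
        λ M σ cocone → σ t , (λ x → cocone (below x)) , λ h commutes →
          let open ≗H-Reasoning in
          begin
            h                 ≈⟨ ∘H-identityʳ h ⟨
            h ∘H idH          ≈⟨ (λ x → cong h (proj₁ system (below t) x)) ⟨
            h ∘H f (below t)  ≈⟨ commutes t ⟩
            σ t               ∎

  module DirectLimit {ι ι' : Level} (I : Set ι) (_≼_ : I → I → Set ι')
         (A : I → OGroup c ℓ₁ ℓ₂) (f : ∀ {i j} → i ≼ j → Hom (A i) (A j))
         (L : OGroup c ℓ₁ ℓ₂) (π : ∀ i → Hom (A i) L)
         (limit : IsDirectLimit I _≼_ A f L π) where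

    mediate : (M : OGroup c ℓ₁ ℓ₂) (σ : ∀ i → Hom (A i) M) → IsCocone I _≼_ A f M σ → Hom L M
    mediate M σ cocone = proj₁ (proj₂ limit M σ cocone)

    mediate-∘π : (M : OGroup c ℓ₁ ℓ₂) (σ : ∀ i → Hom (A i) M) (cocone : IsCocone I _≼_ A f M σ) →
                 ∀ i → (mediate M σ cocone ∘H π i) ≗H σ i
    mediate-∘π M σ cocone = proj₁ (proj₂ (proj₂ limit M σ cocone))

    jointly-epic : {M : OGroup c ℓ₁ ℓ₂} (h h' : Hom L M) →
                   (∀ i → (h ∘H π i) ≗H (h' ∘H π i)) → h ≗H h'
    jointly-epic {M} h h' agree =
      begin
        h  ≈⟨ unique h (λ _ _ → OGroup.refl M) ⟩
        mediate M (λ i → h ∘H π i) cocone  ≈⟨ unique h' (λ i x → OGroup.sym M (agree i x)) ⟨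
        h' ∎
      where
      open ≗H-Reasoning

      cocone : IsCocone I _≼_ A f M (λ i → h ∘H π i)
      cocone p x = cong h (proj₁ limit p x)

      unique : ∀ h'' → (∀ i → (h'' ∘H π i) ≗H (h ∘H π i)) →
               h'' ≗H mediate M (λ i → h ∘H π i) cocone
      unique = proj₂ (proj₂ (proj₂ limit M (λ i → h ∘H π i) cocone))

module Extension {c ℓ₁ ℓ₂ ι ι' κ : Level}
    (β : Set ι) (_≤_ : β → β → Set ι')
    (isTO : IsTotalOrder _≡_ _≤_)
    (≤-irr : ∀ {x y} (p q : x ≤ y) → p ≡ q)
    (α : Set κ) (e : α → β)
    (A : α → OGroup c ℓ₁ ℓ₂)
    (f : ∀ {a b} → e a ≤ e b → Hom (A a) (A b))
    (sysA : IsDirectSystem α (λ a b → e a ≤ e b) A f)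
    (B : β → OGroup c ℓ₁ ℓ₂)
    (π : ∀ (s : β) (k : α) → e k ≤ s → Hom (A k) (B s))
    (limB : ∀ (s : β) →
       IsDirectLimit (Σ α (λ k → e k ≤ s)) (λ x y → e (proj₁ x) ≤ e (proj₁ y))
         (λ x → A (proj₁ x)) f (B s) (λ x → π s (proj₁ x) (proj₂ x))) where

  open IsTotalOrder isTO using () renaming (refl to ≤-refl; trans to ≤-trans)

  α↓ : β → Set (κ ⊔ ι')
  α↓ s = Σ α (λ k → e k ≤ s)

  IsCocone↓ : (s : β) (M : OGroup c ℓ₁ ℓ₂) → ((x : α↓ s) → Hom (A (proj₁ x)) M) →
              Set (κ ⊔ ι' ⊔ c ⊔ ℓ₁)
  IsCocone↓ s = IsCocone (α↓ s) (λ x y → e (proj₁ x) ≤ e (proj₁ y)) (λ x → A (proj₁ x)) f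

  π↓ : (s : β) (x : α↓ s) → Hom (A (proj₁ x)) (B s)
  π↓ s x = π s (proj₁ x) (proj₂ x)

  module Lim (s : β) = DirectLimit (α↓ s) (λ x y → e (proj₁ x) ≤ e (proj₁ y))
    (λ x → A (proj₁ x)) f (B s) (π↓ s) (limB s)

  π-irrelevant : ∀ s k (q q' : e k ≤ s) → π s k q ≗H π s k q'
  π-irrelevant s k q q' with ≤-irr q q'
  ... | refl = λ _ → OGroup.refl (B s)

  π-cocone : ∀ s {k k'} (q : e k ≤ s) (q' : e k' ≤ s) (p : e k ≤ e k') →
             (π s k' q' ∘H f p) ≗H π s k q
  π-cocone s q q' p = proj₁ (limB s) {_ , q} {_ , q'} p

  π-jointly-epic : ∀ {s M} (h h' : Hom (B s) M) →
                   (∀ k (q : e k ≤ s) → (h ∘H π s k q) ≗H (h' ∘H π s k q)) → h ≗H h'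
  π-jointly-epic {s} h h' agree = Lim.jointly-epic s h h' (λ x → agree (proj₁ x) (proj₂ x))

  module _ {s t : β} (s≤t : s ≤ t) {M : OGroup c ℓ₁ ℓ₂}
           (σ : (x : α↓ t) → Hom (A (proj₁ x)) M) (cocone : IsCocone↓ t M σ) where

    induced : Hom (B s) M
    induced = Lim.mediate s M (λ x → σ (proj₁ x , ≤-trans (proj₂ x) s≤t)) cocone

    induced-∘π : ∀ k (q : e k ≤ s) → (induced ∘H π s k q) ≗H σ (k , ≤-trans q s≤t)
    induced-∘π k q = Lim.mediate-∘π s M _ cocone (k , q)

  f↓ : (w : α) (x : α↓ (e w)) → Hom (A (proj₁ x)) (A w)
  f↓ w x = f (proj₂ x)

  f↓-isCocone : ∀ w → IsCocone↓ (e w) (A w) (f↓ w)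
  f↓-isCocone w = DirectSystem.below-isCocone α (λ a b → e a ≤ e b) A f sysA proj₁ proj₂

  g : ∀ {i j} → i ≤ j → Hom (B i) (B j)
  g {j = j} p = induced p (π↓ j) (proj₁ (limB j))

  g-∘π : ∀ {i j} (p : i ≤ j) k (q : e k ≤ i) → (g p ∘H π i k q) ≗H π j k (≤-trans q p)
  g-∘π {j = j} p = induced-∘π p (π↓ j) (proj₁ (limB j))

  φ : ∀ {i w} → i ≤ e w → Hom (B i) (A w)
  φ {w = w} p = induced p (f↓ w) (f↓-isCocone w)

  φ-∘π : ∀ {i w} (p : i ≤ e w) k (q : e k ≤ i) → (φ p ∘H π i k q) ≗H f (≤-trans q p)
  φ-∘π {w = w} p = induced-∘π p (f↓ w) (f↓-isCocone w)

  g-∘π-refl : ∀ {j} k (q : e k ≤ j) → (g q ∘H π (e k) k ≤-refl) ≗H π j k q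
  g-∘π-refl {j} k q = begin
    g q ∘H π (e k) k ≤-refl     ≈⟨ g-∘π q k ≤-refl ⟩
    π j k (≤-trans ≤-refl q)    ≈⟨ π-irrelevant j k (≤-trans ≤-refl q) q ⟩
    π j k q                     ∎
    where open ≗H-Reasoning

  g-identity : ∀ {i} (p : i ≤ i) → g p ≗H idH
  g-identity {i} p = π-jointly-epic (g p) idH λ k q → begin
    g p ∘H π i k q            ≈⟨ g-∘π p k q ⟩
    π i k (≤-trans q p)       ≈⟨ π-irrelevant i k (≤-trans q p) q ⟩
    π i k q                   ∎
    where open ≗H-Reasoning

  g-compose : ∀ {i j l} (p : i ≤ j) (q : j ≤ l) (r : i ≤ l) → g r ≗H (g q ∘H g p)
  g-compose {i} {j} {l} p q r = π-jointly-epic (g r) (g q ∘H g p) λ k s → begin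
    g r ∘H π i k s                       ≈⟨ g-∘π r k s ⟩
    π l k (≤-trans s r)                  ≈⟨ π-irrelevant l k _ _ ⟩
    π l k (≤-trans (≤-trans s p) q)      ≈⟨ g-∘π q k (≤-trans s p) ⟨
    g q ∘H π j k (≤-trans s p)           ≈⟨ (λ x → cong (g q) (g-∘π p k s x)) ⟨
    (g q ∘H g p) ∘H π i k s              ∎
    where open ≗H-Reasoning

  g-isDirectSystem : IsDirectSystem β _≤_ B g
  g-isDirectSystem = g-identity , g-compose

  g-factors : ∀ {i j w} (p : i ≤ j) (p₁ : i ≤ e w) (p₂ : e w ≤ j) → g p ≗H (π j w p₂ ∘H φ p₁)
  g-factors {i} {j} {w} p p₁ p₂ = π-jointly-epic (g p) (π j w p₂ ∘H φ p₁) λ k q → begin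
    g p ∘H π i k q                        ≈⟨ g-∘π p k q ⟩
    π j k (≤-trans q p)                   ≈⟨ π-cocone j (≤-trans q p) p₂ (≤-trans q p₁) ⟨
    π j w p₂ ∘H f (≤-trans q p₁)          ≈⟨ (λ x → cong (π j w p₂) (φ-∘π p₁ k q x)) ⟨
    (π j w p₂ ∘H φ p₁) ∘H π i k q         ∎
    where open ≗H-Reasoning

  g-extends : ∀ a b (p : e a ≤ e b) →
              (g p ∘H π (e a) a ≤-refl) ≗H (π (e b) b ≤-refl ∘H f p)
  g-extends a b p = begin
    g p ∘H π (e a) a ≤-refl       ≈⟨ g-∘π-refl a p ⟩
    π (e b) a p                   ≈⟨ π-cocone (e b) p ≤-refl p ⟨
    π (e b) b ≤-refl ∘H f p       ∎
    where open ≗H-Reasoning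

  B-isLimit-atMost : ∀ a →
    IsDirectLimit (Σ β (λ i → i ≤ e a)) (λ x y → proj₁ x ≤ proj₁ y)
      (λ x → B (proj₁ x)) g (B (e a)) (λ x → g (proj₂ x))
  B-isLimit-atMost a =
    DirectSystem.greatest-isDirectLimit β _≤_ B g g-isDirectSystem proj₁ (e a , ≤-refl) proj₂

  β< : β → Set (ι ⊔ ι')
  β< s = Σ β (λ i → Strict _≤_ i s)

  IsCocone< : (s : β) (M : OGroup c ℓ₁ ℓ₂) → ((x : β< s) → Hom (B (proj₁ x)) M) → Set (ι ⊔ ι' ⊔ c ⊔ ℓ₁)
  IsCocone< s = IsCocone (β< s) (λ x y → proj₁ x ≤ proj₁ y) (λ x → B (proj₁ x)) g

  module _ {s : β} (s∉α : ¬ Σ α (λ a → e a ≡ s)) {M : OGroup c ℓ₁ ℓ₂}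
           (σ : (x : β< s) → Hom (B (proj₁ x)) M) (cocone : IsCocone< s M σ) where
    open ≗H-Reasoning

    below : ∀ k → e k ≤ s → Strict _≤_ (e k) s
    below k q = q , λ ek≡s → s∉α (k , ek≡s)

    σ↓ : (x : α↓ s) → Hom (A (proj₁ x)) M
    σ↓ (k , q) = σ (e k , below k q) ∘H π (e k) k ≤-refl

    σ↓-isCocone : IsCocone↓ s M σ↓
    σ↓-isCocone {k , q} {k' , q'} p = begin
      (σ (e k' , below k' q') ∘H π (e k') k' ≤-refl) ∘H f p
        ≈⟨ (λ x → cong (σ (e k' , below k' q')) (π-cocone (e k') p ≤-refl p x)) ⟩
      σ (e k' , below k' q') ∘H π (e k') k p
        ≈⟨ (λ x → cong (σ (e k' , below k' q')) (g-∘π-refl k p x)) ⟨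
      (σ (e k' , below k' q') ∘H g p) ∘H π (e k) k ≤-refl
        ≈⟨ (λ x → cocone p (⟦ π (e k) k ≤-refl ⟧ x)) ⟩
      σ (e k , below k q) ∘H π (e k) k ≤-refl  ∎

    mediate< : Hom (B s) M
    mediate< = Lim.mediate s M σ↓ σ↓-isCocone

    mediate<-∘g : ∀ x → (mediate< ∘H g (proj₁ (proj₂ x))) ≗H σ x
    mediate<-∘g x@(i , i≤s , _) = π-jointly-epic (mediate< ∘H g i≤s) (σ x) λ k q → begin
      (mediate< ∘H g i≤s) ∘H π i k q
        ≈⟨ (λ y → cong mediate< (g-∘π i≤s k q y)) ⟩
      mediate< ∘H π s k (≤-trans q i≤s)
        ≈⟨ Lim.mediate-∘π s M σ↓ σ↓-isCocone (k , _) ⟩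
      σ↓ (k , ≤-trans q i≤s)
        ≈⟨ (λ y → cocone q (⟦ π (e k) k ≤-refl ⟧ y)) ⟨
      (σ x ∘H g q) ∘H π (e k) k ≤-refl
        ≈⟨ (λ y → cong (σ x) (g-∘π-refl k q y)) ⟩
      σ x ∘H π i k q  ∎

    mediate<-unique : ∀ h → (∀ x → (h ∘H g (proj₁ (proj₂ x))) ≗H σ x) → h ≗H mediate<
    mediate<-unique h commutes = π-jointly-epic h mediate< λ k q → begin
      h ∘H π s k q
        ≈⟨ (λ y → cong h (g-∘π-refl k q y)) ⟨
      (h ∘H g q) ∘H π (e k) k ≤-refl
        ≈⟨ (λ y → commutes (e k , below k q) (⟦ π (e k) k ≤-refl ⟧ y)) ⟩
      σ↓ (k , q)
        ≈⟨ Lim.mediate-∘π s M σ↓ σ↓-isCocone (k , q) ⟨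
      mediate< ∘H π s k q  ∎

  B-isLimit-below : ∀ s → ¬ Σ α (λ a → e a ≡ s) →
    IsDirectLimit (β< s) (λ x y → proj₁ x ≤ proj₁ y)
      (λ x → B (proj₁ x)) g (B s) (λ x → g (proj₁ (proj₂ x)))
  B-isLimit-below s s∉α =
    -- η-expanded: the indices x, y cannot be recovered by unification from proj₁ x, proj₁ y
    (λ {x} {y} → DirectSystem.below-isCocone β _≤_ B g g-isDirectSystem
                   proj₁ (λ z → proj₁ (proj₂ z)) {x} {y}) ,
    λ M σ cocone →
      mediate< s∉α σ cocone , mediate<-∘g s∉α σ cocone , mediate<-unique s∉α σ cocone

lemma4p1 :
  ∀ {c ℓ₁ ℓ₂ ι ι' κ : Level}
  -- the chain (β , ≤)
  (β : Set ι) (_≤_ : β → β → Set ι')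
  (isTO : IsTotalOrder _≡_ _≤_)
  (≤-irr : ∀ {x y} (p q : x ≤ y) → p ≡ q)
  -- the subchain α ⊆ β (with the induced order)
  (α : Set κ) (e : α → β) (e-inj : ∀ {a b} → e a ≡ e b → a ≡ b)
  -- the direct system ⟨A_u , f_{u→v}⟩ over α
  (A : α → OGroup c ℓ₁ ℓ₂)
  (f : ∀ {a b} → e a ≤ e b → Hom (A a) (A b))
  (sysA : IsDirectSystem α (λ a b → e a ≤ e b) A f)
  -- B_s with π_{k→s} (k ∈ α_s) : the direct limit of the restriction to α_s
  (B : β → OGroup c ℓ₁ ℓ₂)
  (π : ∀ (s : β) (k : α) → e k ≤ s → Hom (A k) (B s))
  (limB : ∀ (s : β) →
     IsDirectLimit (Σ α (λ k → e k ≤ s)) (λ x y → e (proj₁ x) ≤ e (proj₁ y))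
       (λ x → A (proj₁ x)) f (B s) (λ x → π s (proj₁ x) (proj₂ x))) →
  -- there are φ and g satisfying all defining clauses (well-definedness) ...
  Σ (∀ (i : β) (w : α) → ¬ Σ α (λ a → e a ≡ i) → Strict _≤_ i (e w) → Hom (B i) (A w))
    (λ φ →
  Σ (∀ {i j : β} → i ≤ j → Hom (B i) (B j))
    (λ g →
    -- φ_{i→w} ∘ π_{k→i} = f_{k→w}
    (∀ i w (ni : ¬ Σ α (λ a → e a ≡ i)) (lt : Strict _≤_ i (e w))
       k (q : e k ≤ i) →
       (φ i w ni lt ∘H π i k q) ≗H f (IsTotalOrder.trans isTO q (proj₁ lt)))
    -- g_{i→i} = id
    × (∀ i (p : i ≤ i) → g p ≗H idH)
    -- i ∈ α , i < j : g_{i→j} = π_{i→j}   (B_i identified with A_i via π_{i→i})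
    × (∀ a j (p : e a ≤ j) → e a ≢ j →
         (g p ∘H π (e a) a (IsTotalOrder.refl isTO)) ≗H π j a p)
    -- i ∉ α , j ∈ α , i < j : g_{i→j} = φ_{i→j}   (A_j identified with B_j via π_{j→j})
    × (∀ i b (p : i ≤ e b) (ni : ¬ Σ α (λ a → e a ≡ i)) (ne : i ≢ e b) →
         g p ≗H (π (e b) b (IsTotalOrder.refl isTO) ∘H φ i b ni (p , ne)))
    -- i , j ∉ α , i < j , no w ∈ α between : g_{i→j} = id_{i→j}
    × (∀ i j (p : i ≤ j) → ¬ Σ α (λ a → e a ≡ i) → ¬ Σ α (λ a → e a ≡ j) → i ≢ j →
         ¬ Σ α (λ w → Strict _≤_ i (e w) × Strict _≤_ (e w) j) →
         ∀ k (q : e k ≤ i) →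
         (g p ∘H π i k q) ≗H π j k (IsTotalOrder.trans isTO q p))
    -- i , j ∉ α , w ∈ α with i < w < j (for EVERY such w) : g_{i→j} = π_{w→j} ∘ φ_{i→w}
    × (∀ i j (p : i ≤ j) (ni : ¬ Σ α (λ a → e a ≡ i)) → ¬ Σ α (λ a → e a ≡ j) →
         ∀ w (lt₁ : Strict _≤_ i (e w)) (lt₂ : Strict _≤_ (e w) j) →
         g p ≗H (π j w (proj₁ lt₂) ∘H φ i w ni lt₁))
    -- ... and ⟨B_u , g_{u→v}⟩ is a direct system over β ...
    × IsDirectSystem β _≤_ B g
    -- ... extending ⟨A_u , f_{u→v}⟩ (via the identifications π_{a→a} : A_a ≅ B_a)
    × (∀ a b (p : e a ≤ e b) →
         (g p ∘H π (e a) a (IsTotalOrder.refl isTO))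
           ≗H (π (e b) b (IsTotalOrder.refl isTO) ∘H f p))
    -- for s ∉ α, B_s is the direct limit of the restriction to {i ∈ β : i < s}
    × (∀ s → ¬ Σ α (λ a → e a ≡ s) →
         IsDirectLimit (Σ β (λ i → Strict _≤_ i s)) (λ x y → proj₁ x ≤ proj₁ y)
           (λ x → B (proj₁ x)) g (B s) (λ x → g (proj₁ (proj₂ x))))
    -- for s ∈ α, B_s is the direct limit of the restriction to {i ∈ β : i ≤ s}
    × (∀ a →
         IsDirectLimit (Σ β (λ i → i ≤ e a)) (λ x y → proj₁ x ≤ proj₁ y)
           (λ x → B (proj₁ x)) g (B (e a)) (λ x → g (proj₂ x)))))

lemma4p1 β _≤_ isTO ≤-irr α e _ A f sysA B π limB =
    (λ _ _ _ lt → φ (proj₁ lt))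
  , g
  , (λ _ _ _ lt → φ-∘π (proj₁ lt))
  , (λ _ → g-identity)
  , (λ a _ p _ → g-∘π-refl a p)
  , (λ _ _ p _ _ → g-factors p p (IsTotalOrder.refl isTO))
  , (λ _ _ p _ _ _ _ → g-∘π p)
  , (λ _ _ p _ _ _ lt₁ lt₂ → g-factors p (proj₁ lt₁) (proj₁ lt₂))
  , g-isDirectSystem
  , g-extends
  , B-isLimit-below
  , B-isLimit-atMost
  where open Extension β _≤_ isTO ≤-irr α e A f sysA B π limB
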